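{- Let $q$ be a prime power and $n,d$ positive integers. For $\mathbf{a}_i=(a_{i,1},\ldots,a_{i,n+1})\in\mathbb{F}_q^{n+1}$, $1\le i\le d$, let $$F_{\mathbf{a}_1,\ldots,\mathbf{a}_d}=\Big\{(x_1,\ldots,x_{n+d})\in\mathbb{F}_q^{n+d}:\ x_{n+i}=\sum_{j=1}^n a_{i,j}x_j+a_{i,n+1}\ \text{for all }1\le i\le d\Big\}.$$ Let $\mathcal{P}$ be a set of points in $\mathbb{F}_q^{n+d}$ and $\mathcal{F}$ a set of $n$-flats of the form $F_{\mathbf{a}_1,\ldots,\mathbf{a}_d}$. Then, if $d\ge2$, $$\left|I(\mathcal{P},\mathcal{F})-\frac{|\mathcal{P}||\mathcal{F}|}{q^d}\right|\le q^{n/2}\sqrt{|\mathcal{P}||\mathcal{F}|}\left(1+\frac{|\mathcal{F}|}{q}\right)^{1/2},$$ and if $d=1$, $$\left|I(\mathcal{P},\mathcal{F})-\frac{|\mathcal{P}||\mathcal{F}|}{q}\right|\le q^{n/2}\left(1-\frac1q\right)\sqrt{|\mathcal{P}||\mathcal{F}|}.$$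
   Context: $I(\mathcal{P},\mathcal{F})$ denotes the number of pairs $(\mathbf{p},F)\in\mathcal{P}\times\mathcal{F}$ with $\mathbf{p}\in F$. -}

module Defs where

open import Level using (0ℓ)
open import Data.Nat using (ℕ; zero; suc; _+_)
open import Data.Fin using (Fin; zero; suc; fromℕ; inject₁; _↑ˡ_; _↑ʳ_)
open import Data.Fin.Properties using (all?)
open import Data.Vec using (Vec; lookup)
open import Data.List using (List; length; filter; map)
open import Data.Nat.ListAction using (sum)
open import Data.Product using (∃)
open import Relation.Nullary using (¬_; Dec)
open import Relation.Unary using (Decidable)
open import Relation.Binary.PropositionalEquality using (_≡_)
open import Relation.Binary.Definitions using (DecidableEquality)
open import Algebra.Structures using (IsCommutativeRing)
open import Function.Bundles using (_↔_)

-- A finite field with exactly q elements (equality is propositional).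
-- Such a field exists iff q is a prime power, and it is then 𝔽_q.
record FiniteField (q : ℕ) : Set₁ where
  infixl 7 _*_
  infixl 6 _+F_
  field
    Carrier : Set
    _+F_ _*_ : Carrier → Carrier → Carrier
    -F_ : Carrier → Carrier
    0# 1# : Carrier
    isCommutativeRing : IsCommutativeRing _≡_ _+F_ _*_ -F_ 0# 1#
    0≢1 : ¬ (0# ≡ 1#)
    inverse : ∀ x → ¬ (x ≡ 0#) → ∃ λ y → x * y ≡ 1#
    _≟_ : DecidableEquality Carrier
    enumeration : Fin q ↔ Carrier

module _ {q : ℕ} (𝔽 : FiniteField q) where
  open FiniteField 𝔽

  ΣF : (m : ℕ) → (Fin m → Carrier) → Carrier
  ΣF zero    f = 0#
  ΣF (suc m) f = f zero +F ΣF m (λ j → f (suc j))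

  OnFlat : (n d : ℕ) → Vec Carrier (n + d) → Vec (Vec Carrier (suc n)) d → Set
  OnFlat n d x a =
    ∀ (i : Fin d) →
      lookup x (n ↑ʳ i) ≡
        ΣF n (λ j → lookup (lookup a i) (inject₁ j) * lookup x (j ↑ˡ d))
        +F lookup (lookup a i) (fromℕ n)

  onFlat? : (n d : ℕ) → (x : Vec Carrier (n + d)) → (a : Vec (Vec Carrier (suc n)) d) → Dec (OnFlat n d x a)
  onFlat? n d x a = all? (λ i → lookup x (n ↑ʳ i) ≟ _)

  incidences : (n d : ℕ) → List (Vec Carrier (n + d)) → List (Vec (Vec Carrier (suc n)) d) → ℕ
  incidences n d P F = sum (map (λ p → length (filter (onFlat? n d p) F)) P)

{-# OPTIONS --safe #-}
-- Let r(u) be the number of flats of F through the point u of 𝔽_q^{n+d}, so I = ∑_{u ∈ P} r(u).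
-- Each flat has q^n points. Two distinct flats F_a, F_a' differ in some row i, and on their
-- intersection the affine equation ⟨a_i - a'_i, (x, 1)⟩ = 0 holds for x ∈ 𝔽_q^n; it has q^(n-1)
-- solutions or none. Hence q ∑_u r(u)² ≤ q^n |F| (|F| + q - 1), so e(u) = q^d r(u) - |F| has
-- small ℓ²-norm, and Cauchy–Schwarz for ∑_u 1_P(u) e(u) = q^d I - |P| |F| gives the first bound.
-- For d = 1, pair e instead with q^d 1_P - π, where π(u) counts the points of P in the vertical
-- fibre of u (same first n coordinates). Each fibre meets each flat exactly once, so e is
-- orthogonal to π, and ∑ (q^d 1_P - π)² ≤ q^d |P| (q^d - 1) yields the factor (1 - 1/q).
module Submission where

open import Defs
open import Level using (Level; 0ℓ)
open import Algebra.Bundles using (CommutativeRing)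
open import Data.Fin using (Fin; zero; suc; inject₁; fromℕ; _↑ˡ_)
open import Data.Integer
  using (ℤ; +_; -[1+_]; _+_; _*_; _-_; -_; _≤_; _^_; 0ℤ; 1ℤ; +≤+; +<+; Positive; positive; nonNegative)
import Data.Integer.Properties as ℤ
open import Data.Integer.Tactic.RingSolver using (solve-∀)
open import Data.List as List using (List; []; _∷_; _++_; length; filter; map; cartesianProductWith)
open import Data.List.Properties using (length-tabulate)
open import Data.List.Membership.Propositional using (_∈_; _∉_)
open import Data.List.Membership.Propositional.Properties using (∈-tabulate⁺)
open import Data.List.Relation.Unary.Any using (here; there)
import Data.List.Relation.Unary.All as All
open import Data.List.Relation.Unary.All.Properties using (All¬⇒¬Any)
open import Data.List.Relation.Unary.AllPairs using (_∷_)
open import Data.List.Relation.Unary.Unique.Propositional using (Unique)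
open import Data.List.Relation.Unary.Unique.Propositional.Properties using (tabulate⁺)
open import Data.Nat as ℕ using (ℕ; zero; suc)
import Data.Nat.Properties as ℕ
open import Data.Nat.ListAction using (sum)
open import Data.Product using (_×_; _,_; proj₁; proj₂)
open import Data.Vec as Vec using (Vec; []; _∷_; lookup)
import Data.Vec.Properties as Vec
open import Data.Vec.Relation.Binary.Pointwise.Extensional using (ext; Pointwise-≡⇒≡)
open import Function.Base using (_∘_)
open import Function.Bundles using (Inverse; Equivalence; _⇔_; mk⇔)
open import Function.Construct.Composition using (_⇔-∘_)
open import Relation.Binary.Definitions using (DecidableEquality)
open import Relation.Binary.PropositionalEquality
open import Relation.Nullary using (¬_; Dec; yes; no; contradiction)
open import Relation.Unary using (Decidable)

private
  variable
    a b c : Level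
    A B C : Set a

-- Indicators and Kronecker deltas

𝟙 : ∀ {p} {P : Set p} → Dec P → ℤ
𝟙 (yes _) = 1ℤ
𝟙 (no _)  = 0ℤ

module _ {p} {P : Set p} where

  𝟙-yes : (P? : Dec P) → P → 𝟙 P? ≡ 1ℤ
  𝟙-yes (yes _) _  = refl
  𝟙-yes (no ¬x) x = contradiction x ¬x

  𝟙-no : (P? : Dec P) → ¬ P → 𝟙 P? ≡ 0ℤ
  𝟙-no (yes x) ¬x = contradiction x ¬x
  𝟙-no (no _)  _  = refl

  𝟙-nonNeg : (P? : Dec P) → 0ℤ ≤ 𝟙 P?
  𝟙-nonNeg (yes _) = +≤+ ℕ.z≤n
  𝟙-nonNeg (no _)  = +≤+ ℕ.z≤n

  𝟙≤1 : (P? : Dec P) → 𝟙 P? ≤ 1ℤ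
  𝟙≤1 (yes _) = ℤ.≤-refl
  𝟙≤1 (no _)  = +≤+ ℕ.z≤n

  𝟙-cong : ∀ {r} {R : Set r} → P ⇔ R → (P? : Dec P) (R? : Dec R) → 𝟙 P? ≡ 𝟙 R?
  𝟙-cong P⇔R P? (yes r) = 𝟙-yes P? (Equivalence.from P⇔R r)
  𝟙-cong P⇔R P? (no ¬r) = 𝟙-no P? (λ x → ¬r (Equivalence.to P⇔R x))

module _ {A : Set a} (_≟_ : DecidableEquality A) where

  δ : A → A → ℤ
  δ x y = 𝟙 (x ≟ y)

  δ-refl : ∀ x → δ x x ≡ 1ℤ
  δ-refl x = 𝟙-yes (x ≟ x) refl

  δ-≢ : ∀ {x y} → x ≢ y → δ x y ≡ 0ℤ
  δ-≢ {x} {y} = 𝟙-no (x ≟ y)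

  δ-sym : ∀ x y → δ x y ≡ δ y x
  δ-sym x y = 𝟙-cong (mk⇔ sym sym) (x ≟ y) (y ≟ x)

  δ-nonNeg : ∀ x y → 0ℤ ≤ δ x y
  δ-nonNeg x y = 𝟙-nonNeg (x ≟ y)

module _ {A : Set a} (_≟_ : DecidableEquality A) where

  private
    _≟ᵥ_ : ∀ {m} → DecidableEquality (Vec A m)
    _≟ᵥ_ = Vec.≡-dec _≟_

  δ-∷ : ∀ {m} x y (xs ys : Vec A m) →
        δ _≟ᵥ_ (x ∷ xs) (y ∷ ys) ≡ δ _≟_ x y * δ _≟ᵥ_ xs ys
  δ-∷ x y xs ys = by-cases (x ≟ y)
    where
    by-cases : Dec (x ≡ y) → δ _≟ᵥ_ (x ∷ xs) (y ∷ ys) ≡ δ _≟_ x y * δ _≟ᵥ_ xs ys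
    by-cases (yes refl) = begin
      δ _≟ᵥ_ (x ∷ xs) (x ∷ ys)
        ≡⟨ 𝟙-cong (mk⇔ Vec.∷-injectiveʳ (cong (x ∷_))) ((x ∷ xs) ≟ᵥ (x ∷ ys)) (xs ≟ᵥ ys) ⟩
      δ _≟ᵥ_ xs ys             ≡⟨ ℤ.*-identityˡ (δ _≟ᵥ_ xs ys) ⟨
      1ℤ * δ _≟ᵥ_ xs ys        ≡⟨ cong (_* δ _≟ᵥ_ xs ys) (δ-refl _≟_ x) ⟨
      δ _≟_ x x * δ _≟ᵥ_ xs ys ∎
      where open ≡-Reasoning
    by-cases (no x≢y) = begin
      δ _≟ᵥ_ (x ∷ xs) (y ∷ ys) ≡⟨ 𝟙-no ((x ∷ xs) ≟ᵥ (y ∷ ys)) (x≢y ∘ Vec.∷-injectiveˡ) ⟩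
      0ℤ                       ≡⟨ ℤ.*-zeroˡ (δ _≟ᵥ_ xs ys) ⟨
      0ℤ * δ _≟ᵥ_ xs ys        ≡⟨ cong (_* δ _≟ᵥ_ xs ys) (δ-≢ _≟_ x≢y) ⟨
      δ _≟_ x y * δ _≟ᵥ_ xs ys ∎
      where open ≡-Reasoning

  δ-∷-≤ : ∀ {m} x y (xs ys : Vec A m) → δ _≟ᵥ_ (x ∷ xs) (y ∷ ys) ≤ δ _≟_ x y
  δ-∷-≤ x y xs ys = begin
    δ _≟ᵥ_ (x ∷ xs) (y ∷ ys)  ≡⟨ δ-∷ x y xs ys ⟩
    δ _≟_ x y * δ _≟ᵥ_ xs ys  ≤⟨ ℤ.*-monoˡ-≤-nonNeg (δ _≟_ x y) {{nonNegative (δ-nonNeg _≟_ x y)}}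
                                                     (𝟙≤1 (xs ≟ᵥ ys)) ⟩
    δ _≟_ x y * 1ℤ            ≡⟨ ℤ.*-identityʳ _ ⟩
    δ _≟_ x y                 ∎
    where open ℤ.≤-Reasoning

-- Finite sums

∑ : List A → (A → ℤ) → ℤ
∑ []       g = 0ℤ
∑ (x ∷ xs) g = g x + ∑ xs g

syntax ∑ xs (λ x → e) = ∑[ x ← xs ] e

∑-cong : ∀ (xs : List A) {f g : A → ℤ} → (∀ x → f x ≡ g x) → ∑ xs f ≡ ∑ xs g
∑-cong []       f≗g = refl
∑-cong (x ∷ xs) f≗g = cong₂ _+_ (f≗g x) (∑-cong xs f≗g)

∑-cong-∈ : ∀ (xs : List A) {f g : A → ℤ} → (∀ {x} → x ∈ xs → f x ≡ g x) → ∑ xs f ≡ ∑ xs g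
∑-cong-∈ []       f≗g = refl
∑-cong-∈ (x ∷ xs) f≗g = cong₂ _+_ (f≗g (here refl)) (∑-cong-∈ xs (f≗g ∘ there))

∑-zero : ∀ (xs : List A) → ∑[ x ← xs ] 0ℤ ≡ 0ℤ
∑-zero []       = refl
∑-zero (x ∷ xs) = trans (ℤ.+-identityˡ _) (∑-zero xs)

∑-distrib-+ : ∀ (xs : List A) (f g : A → ℤ) → ∑[ x ← xs ] (f x + g x) ≡ ∑ xs f + ∑ xs g
∑-distrib-+ []       f g = refl
∑-distrib-+ (x ∷ xs) f g = trans (cong (_+_ (f x + g x)) (∑-distrib-+ xs f g))
                                 (interchange (f x) (g x) (∑ xs f) (∑ xs g))
  where
  interchange : ∀ a b c d → a + b + (c + d) ≡ a + c + (b + d)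
  interchange = solve-∀

*-distribˡ-∑ : ∀ c (xs : List A) (f : A → ℤ) → c * ∑ xs f ≡ ∑[ x ← xs ] (c * f x)
*-distribˡ-∑ c []       f = ℤ.*-zeroʳ c
*-distribˡ-∑ c (x ∷ xs) f = trans (ℤ.*-distribˡ-+ c (f x) (∑ xs f))
                                  (cong (_+_ (c * f x)) (*-distribˡ-∑ c xs f))

*-distribʳ-∑ : ∀ c (xs : List A) (f : A → ℤ) → ∑ xs f * c ≡ ∑[ x ← xs ] (f x * c)
*-distribʳ-∑ c xs f = trans (ℤ.*-comm (∑ xs f) c)
                            (trans (*-distribˡ-∑ c xs f) (∑-cong xs (λ x → ℤ.*-comm c (f x))))

∑-distrib-- : ∀ (xs : List A) (f g : A → ℤ) → ∑[ x ← xs ] (f x - g x) ≡ ∑ xs f - ∑ xs g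
∑-distrib-- xs f g = begin
  ∑[ x ← xs ] (f x - g x)            ≡⟨ ∑-cong xs (λ x → cong (_+_ (f x)) (ℤ.-1*i≡-i (g x))) ⟨
  ∑[ x ← xs ] (f x + - 1ℤ * g x)     ≡⟨ ∑-distrib-+ xs f (λ x → - 1ℤ * g x) ⟩
  ∑ xs f + ∑[ x ← xs ] (- 1ℤ * g x)  ≡⟨ cong (_+_ (∑ xs f)) (*-distribˡ-∑ (- 1ℤ) xs g) ⟨
  ∑ xs f + - 1ℤ * ∑ xs g             ≡⟨ cong (_+_ (∑ xs f)) (ℤ.-1*i≡-i (∑ xs g)) ⟩
  ∑ xs f - ∑ xs g                    ∎
  where open ≡-Reasoning

∑-const : ∀ (xs : List A) c → ∑[ x ← xs ] c ≡ c * + length xs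
∑-const []       c = sym (ℤ.*-zeroʳ c)
∑-const (x ∷ xs) c = begin
  c + ∑[ x ← xs ] c        ≡⟨ cong (_+_ c) (∑-const xs c) ⟩
  c + c * + length xs      ≡⟨ cong (_+ c * + length xs) (ℤ.*-identityʳ c) ⟨
  c * 1ℤ + c * + length xs ≡⟨ ℤ.*-distribˡ-+ c 1ℤ (+ length xs) ⟨
  c * (1ℤ + + length xs)   ∎
  where open ≡-Reasoning

∑-nonNeg : ∀ (xs : List A) {f : A → ℤ} → (∀ x → 0ℤ ≤ f x) → 0ℤ ≤ ∑ xs f
∑-nonNeg []       0≤f = ℤ.≤-refl
∑-nonNeg (x ∷ xs) 0≤f = ℤ.+-mono-≤ (0≤f x) (∑-nonNeg xs 0≤f)

∑-mono-≤ : ∀ (xs : List A) {f g : A → ℤ} → (∀ x → f x ≤ g x) → ∑ xs f ≤ ∑ xs g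
∑-mono-≤ []       f≤g = ℤ.≤-refl
∑-mono-≤ (x ∷ xs) f≤g = ℤ.+-mono-≤ (f≤g x) (∑-mono-≤ xs f≤g)

∑-mono-≤-∈ : ∀ (xs : List A) {f g : A → ℤ} → (∀ {x} → x ∈ xs → f x ≤ g x) → ∑ xs f ≤ ∑ xs g
∑-mono-≤-∈ []       f≤g = ℤ.≤-refl
∑-mono-≤-∈ (x ∷ xs) f≤g = ℤ.+-mono-≤ (f≤g (here refl)) (∑-mono-≤-∈ xs (f≤g ∘ there))

∈⇒≤∑ : ∀ {xs : List A} {f : A → ℤ} {x} → (∀ y → 0ℤ ≤ f y) → x ∈ xs → f x ≤ ∑ xs f
∈⇒≤∑ {xs = y ∷ ys} {f} 0≤f (here refl) =
  ℤ.i≤i+j (f y) (∑ ys f) {{nonNegative (∑-nonNeg ys 0≤f)}}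
∈⇒≤∑ {xs = y ∷ ys} {f} 0≤f (there x∈ys) =
  ℤ.i≤j⇒i≤k+j (f y) {{nonNegative (0≤f y)}} (∈⇒≤∑ 0≤f x∈ys)

∑-++ : ∀ (xs ys : List A) (f : A → ℤ) → ∑ (xs ++ ys) f ≡ ∑ xs f + ∑ ys f
∑-++ []       ys f = sym (ℤ.+-identityˡ (∑ ys f))
∑-++ (x ∷ xs) ys f = trans (cong (_+_ (f x)) (∑-++ xs ys f)) (sym (ℤ.+-assoc (f x) (∑ xs f) (∑ ys f)))

∑-map : ∀ (h : B → A) (ys : List B) (f : A → ℤ) → ∑ (map h ys) f ≡ ∑[ y ← ys ] f (h y)
∑-map h []       f = refl
∑-map h (y ∷ ys) f = cong (_+_ (f (h y))) (∑-map h ys f)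

∑-cartesianProductWith : ∀ (h : B → C → A) (ys : List B) (zs : List C) (f : A → ℤ) →
  ∑ (cartesianProductWith h ys zs) f ≡ ∑[ y ← ys ] ∑[ z ← zs ] f (h y z)
∑-cartesianProductWith h []       zs f = refl
∑-cartesianProductWith h (y ∷ ys) zs f = begin
  ∑ (map (h y) zs ++ cartesianProductWith h ys zs) f
    ≡⟨ ∑-++ (map (h y) zs) _ f ⟩
  ∑ (map (h y) zs) f + ∑ (cartesianProductWith h ys zs) f
    ≡⟨ cong₂ _+_ (∑-map (h y) zs f) (∑-cartesianProductWith h ys zs f) ⟩
  ∑[ z ← zs ] f (h y z) + ∑[ y ← ys ] ∑[ z ← zs ] f (h y z) ∎
  where open ≡-Reasoning

∑-swap : ∀ (xs : List A) (ys : List B) (g : A → B → ℤ) →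
         ∑[ x ← xs ] ∑[ y ← ys ] g x y ≡ ∑[ y ← ys ] ∑[ x ← xs ] g x y
∑-swap []       ys g = sym (∑-zero ys)
∑-swap (x ∷ xs) ys g = trans (cong (_+_ (∑ ys (g x))) (∑-swap xs ys g))
                             (sym (∑-distrib-+ ys (g x) (λ y → ∑[ x ← xs ] g x y)))

∑-∑-* : ∀ (xs : List A) (ys : List B) (f : A → ℤ) (g : B → ℤ) →
        ∑[ x ← xs ] ∑[ y ← ys ] (f x * g y) ≡ ∑ xs f * ∑ ys g
∑-∑-* xs ys f g = begin
  ∑[ x ← xs ] ∑[ y ← ys ] (f x * g y) ≡⟨ ∑-cong xs (λ x → *-distribˡ-∑ (f x) ys g) ⟨
  ∑[ x ← xs ] (f x * ∑ ys g)          ≡⟨ *-distribʳ-∑ (∑ ys g) xs f ⟨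
  ∑ xs f * ∑ ys g                     ∎
  where open ≡-Reasoning

∑-linear : ∀ (xs : List A) α β (f g : A → ℤ) →
           ∑[ x ← xs ] (α * f x + β * g x) ≡ α * ∑ xs f + β * ∑ xs g
∑-linear xs α β f g = trans (∑-distrib-+ xs (λ x → α * f x) (λ x → β * g x))
                            (sym (cong₂ _+_ (*-distribˡ-∑ α xs f) (*-distribˡ-∑ β xs g)))

∑-linear₃ : ∀ (xs : List A) α β γ (f g h : A → ℤ) →
  ∑[ x ← xs ] (α * f x + β * g x + γ * h x) ≡ α * ∑ xs f + β * ∑ xs g + γ * ∑ xs h
∑-linear₃ xs α β γ f g h = trans (∑-distrib-+ xs (λ x → α * f x + β * g x) (λ x → γ * h x))
                                 (cong₂ _+_ (∑-linear xs α β f g) (sym (*-distribˡ-∑ γ xs h)))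

*-nonNeg : ∀ {i j} → 0ℤ ≤ i → 0ℤ ≤ j → 0ℤ ≤ i * j
*-nonNeg {i} 0≤i 0≤j = ℤ.≤-trans (ℤ.≤-reflexive (sym (ℤ.*-zeroʳ i)))
                                 (ℤ.*-monoˡ-≤-nonNeg i {{nonNegative 0≤i}} 0≤j)

square-nonNeg : ∀ i → 0ℤ ≤ i * i
square-nonNeg (+ n)    = ℤ.≤-trans (+≤+ ℕ.z≤n) (ℤ.≤-reflexive (ℤ.pos-* n n))
square-nonNeg -[1+ n ] = +≤+ ℕ.z≤n

∑-∑-distrib-+ : ∀ (xs : List A) (ys : List B) (u v : A → B → ℤ) →
  ∑[ x ← xs ] ∑[ y ← ys ] (u x y + v x y)
  ≡ ∑[ x ← xs ] ∑[ y ← ys ] u x y + ∑[ x ← xs ] ∑[ y ← ys ] v x y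
∑-∑-distrib-+ xs ys u v = trans (∑-cong xs (λ x → ∑-distrib-+ ys (u x) (v x)))
                                (∑-distrib-+ xs (λ x → ∑ ys (u x)) (λ x → ∑ ys (v x)))

-- Lagrange's identity: ∑ₓ ∑ᵧ (f x g y - f y g x)² = 2 (∑ f² ∑ g² - (∑ f g)²).
cauchy-schwarz : ∀ {A : Set a} (xs : List A) (f g : A → ℤ) →
  ∑[ x ← xs ] (f x * g x) * ∑[ x ← xs ] (f x * g x)
  ≤ ∑[ x ← xs ] (f x * f x) * ∑[ x ← xs ] (g x * g x)
cauchy-schwarz {A = A} xs f g = ℤ.0≤i-j⇒j≤i (ℤ.*-cancelˡ-≤-pos 0ℤ _ (+ 2) (subst (0ℤ ≤_) lagrange
  (∑-nonNeg xs (λ x → ∑-nonNeg xs (λ y → square-nonNeg (f x * g y - f y * g x))))))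
  where
  F G H : A → ℤ
  F x = f x * f x
  G x = g x * g x
  H x = f x * g x
  ∑∑ : (A → A → ℤ) → ℤ
  ∑∑ k = ∑[ x ← xs ] ∑[ y ← xs ] k x y
  expand : ∀ a b c d → (a * d - c * b) * (a * d - c * b)
                     ≡ a * a * (d * d) + (b * b * (c * c) + - (+ 2) * (a * b) * (c * d))
  expand = solve-∀
  collect : ∀ A B C → A * B + (B * A + - (+ 2) * C * C) ≡ + 2 * (A * B - C * C)
  collect = solve-∀
  lagrange : ∑∑ (λ x y → (f x * g y - f y * g x) * (f x * g y - f y * g x))
           ≡ + 2 * (∑ xs F * ∑ xs G - ∑ xs H * ∑ xs H)
  lagrange = begin
    ∑∑ (λ x y → (f x * g y - f y * g x) * (f x * g y - f y * g x))
      ≡⟨ ∑-cong xs (λ x → ∑-cong xs (λ y → expand (f x) (g x) (f y) (g y))) ⟩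
    ∑∑ (λ x y → F x * G y + (G x * F y + - (+ 2) * H x * H y))
      ≡⟨ ∑-∑-distrib-+ xs xs (λ x y → F x * G y) (λ x y → G x * F y + - (+ 2) * H x * H y) ⟩
    ∑∑ (λ x y → F x * G y) + ∑∑ (λ x y → G x * F y + - (+ 2) * H x * H y)
      ≡⟨ cong (_+_ (∑∑ (λ x y → F x * G y)))
              (∑-∑-distrib-+ xs xs (λ x y → G x * F y) (λ x y → - (+ 2) * H x * H y)) ⟩
    ∑∑ (λ x y → F x * G y) + (∑∑ (λ x y → G x * F y) + ∑∑ (λ x y → - (+ 2) * H x * H y))
      ≡⟨ cong₂ _+_ (∑-∑-* xs xs F G)
                   (cong₂ _+_ (∑-∑-* xs xs G F) (∑-∑-* xs xs (λ x → - (+ 2) * H x) H)) ⟩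
    ∑ xs F * ∑ xs G + (∑ xs G * ∑ xs F + ∑[ x ← xs ] (- (+ 2) * H x) * ∑ xs H)
      ≡⟨ cong (λ t → ∑ xs F * ∑ xs G + (∑ xs G * ∑ xs F + t * ∑ xs H))
              (*-distribˡ-∑ (- (+ 2)) xs H) ⟨
    ∑ xs F * ∑ xs G + (∑ xs G * ∑ xs F + - (+ 2) * ∑ xs H * ∑ xs H)
      ≡⟨ collect (∑ xs F) (∑ xs G) (∑ xs H) ⟩
    + 2 * (∑ xs F * ∑ xs G - ∑ xs H * ∑ xs H) ∎
    where open ≡-Reasoning

module _ {A : Set a} (_≟_ : DecidableEquality A) where

  ∑-δ-∉ : ∀ {x} {xs : List A} (g : A → ℤ) → x ∉ xs → ∑[ y ← xs ] (δ _≟_ x y * g y) ≡ 0ℤ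
  ∑-δ-∉ {xs = []}     g x∉xs = refl
  ∑-δ-∉ {xs = y ∷ ys} g x∉xs = cong₂ _+_
    (trans (cong (_* g y) (δ-≢ _≟_ (λ x≡y → x∉xs (here x≡y)))) (ℤ.*-zeroˡ (g y)))
    (∑-δ-∉ g (λ x∈ys → x∉xs (there x∈ys)))

  ∑-δ-unique : ∀ {x} {xs : List A} (g : A → ℤ) → Unique xs → x ∈ xs →
               ∑[ y ← xs ] (δ _≟_ x y * g y) ≡ g x
  ∑-δ-unique {x} {x ∷ ys} g (x∉ys ∷ _) (here refl) = begin
    δ _≟_ x x * g x + ∑[ y ← ys ] (δ _≟_ x y * g y)
      ≡⟨ cong₂ _+_ (cong (_* g x) (δ-refl _≟_ x)) (∑-δ-∉ g (All¬⇒¬Any x∉ys)) ⟩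
    1ℤ * g x + 0ℤ                                   ≡⟨ ℤ.+-identityʳ _ ⟩
    1ℤ * g x                                        ≡⟨ ℤ.*-identityˡ (g x) ⟩
    g x                                             ∎
    where open ≡-Reasoning
  ∑-δ-unique {x} {y ∷ ys} g (y∉ys ∷ ys-unique) (there x∈ys) = begin
    δ _≟_ x y * g y + ∑[ z ← ys ] (δ _≟_ x z * g z)
      ≡⟨ cong₂ _+_ (cong (_* g y) (δ-≢ _≟_ x≢y)) (∑-δ-unique g ys-unique x∈ys) ⟩
    0ℤ * g y + g x                                  ≡⟨ cong (_+ g x) (ℤ.*-zeroˡ (g y)) ⟩
    0ℤ + g x                                        ≡⟨ ℤ.+-identityˡ (g x) ⟩
    g x                                             ∎
    where
    open ≡-Reasoning
    x≢y : x ≢ y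
    x≢y x≡y = All.lookup y∉ys x∈ys (sym x≡y)

  ∑-∑-δ-unique : ∀ {xs : List A} → Unique xs → ∑[ x ← xs ] ∑[ y ← xs ] δ _≟_ x y ≡ + length xs
  ∑-∑-δ-unique {xs} xs-unique = begin
    ∑[ x ← xs ] ∑[ y ← xs ] δ _≟_ x y
      ≡⟨ ∑-cong-∈ xs (λ x∈xs → trans (∑-cong xs (λ y → sym (ℤ.*-identityʳ _)))
                                     (∑-δ-unique (λ _ → 1ℤ) xs-unique x∈xs)) ⟩
    ∑[ x ← xs ] 1ℤ                    ≡⟨ ∑-const xs 1ℤ ⟩
    1ℤ * + length xs                  ≡⟨ ℤ.*-identityˡ _ ⟩
    + length xs                       ∎
    where open ≡-Reasoning

+-sum-map : ∀ (g : A → ℕ) (xs : List A) → + sum (map g xs) ≡ ∑[ x ← xs ] (+ g x)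
+-sum-map g []       = refl
+-sum-map g (x ∷ xs) = trans (ℤ.pos-+ (g x) (sum (map g xs))) (cong (_+_ (+ g x)) (+-sum-map g xs))

+-length-filter : ∀ {p} {P : A → Set p} (P? : Decidable P) (xs : List A) →
                  + length (filter P? xs) ≡ ∑[ x ← xs ] 𝟙 (P? x)
+-length-filter P? []       = refl
+-length-filter P? (x ∷ xs) with P? x
... | yes _ = trans (ℤ.pos-+ 1 (length (filter P? xs))) (cong (_+_ 1ℤ) (+-length-filter P? xs))
... | no _  = trans (+-length-filter P? xs) (sym (ℤ.+-identityˡ _))

take-++ : ∀ {m k} (x : Vec A m) (y : Vec A k) → Vec.take m (x Vec.++ y) ≡ x
take-++ []      y = refl
take-++ (c ∷ x) y = cong (c ∷_) (take-++ x y)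

suc[2d+n∸1]≡d+d+n : ∀ d n → 1 ℕ.≤ d → suc (2 ℕ.* d ℕ.+ n ℕ.∸ 1) ≡ d ℕ.+ d ℕ.+ n
suc[2d+n∸1]≡d+d+n (suc d) n _ = cong (λ k → suc d ℕ.+ suc k ℕ.+ n) (ℕ.+-identityʳ d)

^2≡* : ∀ i → i ^ 2 ≡ i * i
^2≡* i = cong (i *_) (ℤ.*-identityʳ i)

^-nonNeg : ∀ {i} → 0ℤ ≤ i → ∀ m → 0ℤ ≤ i ^ m
^-nonNeg 0≤i zero    = +≤+ ℕ.z≤n
^-nonNeg 0≤i (suc m) = *-nonNeg 0≤i (^-nonNeg 0≤i m)

Fin⇒1≤ : ∀ {k} → Fin k → 1 ℕ.≤ k
Fin⇒1≤ zero    = ℕ.s≤s ℕ.z≤n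
Fin⇒1≤ (suc _) = ℕ.s≤s ℕ.z≤n

-- The affine space 𝔽_q^m and its flats

module AffineSpace {q : ℕ} (𝔽 : FiniteField q) where

  open FiniteField 𝔽 renaming (_*_ to _·_)
  open Inverse enumeration using (to; from; strictlyInverseˡ; strictlyInverseʳ)

  Q : ℤ
  Q = + q

  1≤Q : 1ℤ ≤ Q
  1≤Q = +≤+ (Fin⇒1≤ (from 0#))

  Q≥0 : 0ℤ ≤ Q
  Q≥0 = +≤+ ℕ.z≤n

  instance
    Q-positive : Positive Q
    Q-positive = positive (+<+ (Fin⇒1≤ (from 0#)))

  _≟ᵥ_ : ∀ {m} → DecidableEquality (Vec Carrier m)
  _≟ᵥ_ = Vec.≡-dec _≟_

  elements : List Carrier
  elements = List.tabulate to

  elements-unique : Unique elements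
  elements-unique = tabulate⁺ λ {i} {j} to-i≡to-j → begin
    i             ≡⟨ strictlyInverseʳ i ⟨
    from (to i)   ≡⟨ cong from to-i≡to-j ⟩
    from (to j)   ≡⟨ strictlyInverseʳ j ⟩
    j             ∎
    where open ≡-Reasoning

  ∈-elements : ∀ c → c ∈ elements
  ∈-elements c = subst (_∈ elements) (strictlyInverseˡ c) (∈-tabulate⁺ (from c))

  ∑-elements-δ : ∀ c₀ (g : Carrier → ℤ) → ∑[ c ← elements ] (δ _≟_ c₀ c * g c) ≡ g c₀
  ∑-elements-δ c₀ g = ∑-δ-unique _≟_ g elements-unique (∈-elements c₀)

  ∑-elements-const : ∀ k → ∑[ c ← elements ] k ≡ k * Q
  ∑-elements-const k = trans (∑-const elements k) (cong (λ n → k * + n) (length-tabulate to))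

  vectors : ∀ m → List (Vec Carrier m)
  vectors zero    = [] ∷ []
  vectors (suc m) = cartesianProductWith _∷_ elements (vectors m)

  ∑-vectors-∷ : ∀ m (g : Vec Carrier (suc m) → ℤ) →
                ∑ (vectors (suc m)) g ≡ ∑[ c ← elements ] ∑[ v ← vectors m ] g (c ∷ v)
  ∑-vectors-∷ m g = ∑-cartesianProductWith _∷_ elements (vectors m) g

  ∑-vectors-++ : ∀ m k (g : Vec Carrier (m ℕ.+ k) → ℤ) →
                 ∑ (vectors (m ℕ.+ k)) g ≡ ∑[ x ← vectors m ] ∑[ y ← vectors k ] g (x Vec.++ y)
  ∑-vectors-++ zero    k g = sym (ℤ.+-identityʳ _)
  ∑-vectors-++ (suc m) k g = begin
    ∑ (vectors (suc m ℕ.+ k)) g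
      ≡⟨ ∑-vectors-∷ (m ℕ.+ k) g ⟩
    ∑[ c ← elements ] ∑[ v ← vectors (m ℕ.+ k) ] g (c ∷ v)
      ≡⟨ ∑-cong elements (λ c → ∑-vectors-++ m k (λ v → g (c ∷ v))) ⟩
    ∑[ c ← elements ] ∑[ x ← vectors m ] ∑[ y ← vectors k ] g (c ∷ x Vec.++ y)
      ≡⟨ ∑-vectors-∷ m (λ x → ∑[ y ← vectors k ] g (x Vec.++ y)) ⟨
    ∑[ x ← vectors (suc m) ] ∑[ y ← vectors k ] g (x Vec.++ y) ∎
    where open ≡-Reasoning

  ∑-vectors-const : ∀ m k → ∑[ v ← vectors m ] k ≡ k * Q ^ m
  ∑-vectors-const zero    k = trans (ℤ.+-identityʳ k) (sym (ℤ.*-identityʳ k))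
  ∑-vectors-const (suc m) k = begin
    ∑ (vectors (suc m)) (λ _ → k)        ≡⟨ ∑-vectors-∷ m (λ _ → k) ⟩
    ∑[ c ← elements ] ∑[ v ← vectors m ] k ≡⟨ ∑-cong elements (λ _ → ∑-vectors-const m k) ⟩
    ∑[ c ← elements ] (k * Q ^ m)         ≡⟨ ∑-elements-const (k * Q ^ m) ⟩
    k * Q ^ m * Q                         ≡⟨ ℤ.*-assoc k (Q ^ m) Q ⟩
    k * (Q ^ m * Q)                       ≡⟨ cong (k *_) (ℤ.*-comm (Q ^ m) Q) ⟩
    k * Q ^ suc m                         ∎
    where open ≡-Reasoning

  ∑-vectors-δ : ∀ m v₀ (g : Vec Carrier m → ℤ) → ∑[ v ← vectors m ] (δ _≟ᵥ_ v₀ v * g v) ≡ g v₀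
  ∑-vectors-δ zero    []         g = trans (ℤ.+-identityʳ _) (ℤ.*-identityˡ (g []))
  ∑-vectors-δ (suc m) (c₀ ∷ v₀) g = begin
    ∑ (vectors (suc m)) (λ v → δ _≟ᵥ_ (c₀ ∷ v₀) v * g v)
      ≡⟨ ∑-vectors-∷ m _ ⟩
    ∑[ c ← elements ] ∑[ v ← vectors m ] (δ _≟ᵥ_ (c₀ ∷ v₀) (c ∷ v) * g (c ∷ v))
      ≡⟨ ∑-cong elements (λ c → ∑-cong (vectors m) (λ v →
           trans (cong (_* g (c ∷ v)) (δ-∷ _≟_ c₀ c v₀ v)) (ℤ.*-assoc (δ _≟_ c₀ c) _ _))) ⟩
    ∑[ c ← elements ] ∑[ v ← vectors m ] (δ _≟_ c₀ c * (δ _≟ᵥ_ v₀ v * g (c ∷ v)))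
      ≡⟨ ∑-cong elements (λ c → *-distribˡ-∑ (δ _≟_ c₀ c) (vectors m) _) ⟨
    ∑[ c ← elements ] (δ _≟_ c₀ c * ∑[ v ← vectors m ] (δ _≟ᵥ_ v₀ v * g (c ∷ v)))
      ≡⟨ ∑-cong elements (λ c → cong (δ _≟_ c₀ c *_) (∑-vectors-δ m v₀ (λ v → g (c ∷ v)))) ⟩
    ∑[ c ← elements ] (δ _≟_ c₀ c * g (c ∷ v₀))
      ≡⟨ ∑-elements-δ c₀ (λ c → g (c ∷ v₀)) ⟩
    g (c₀ ∷ v₀) ∎
    where open ≡-Reasoning

  ∑-vectors-δ₁ : ∀ m v₀ → ∑[ v ← vectors m ] δ _≟ᵥ_ v₀ v ≡ 1ℤ
  ∑-vectors-δ₁ m v₀ = trans (∑-cong (vectors m) (λ v → sym (ℤ.*-identityʳ _)))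
                            (∑-vectors-δ m v₀ (λ _ → 1ℤ))

  private
    𝔽-ring : CommutativeRing 0ℓ 0ℓ
    𝔽-ring = record { isCommutativeRing = isCommutativeRing }

  open CommutativeRing 𝔽-ring using (+-abelianGroup; +-commutativeSemigroup; ring;
                                     +-assoc; *-assoc; *-comm; *-identityˡ; -‿inverseˡ)
  open import Algebra.Properties.AbelianGroup +-abelianGroup
    using (x≈y⇒x∙y⁻¹≈ε; x∙y⁻¹≈ε⇒x≈y; inverseˡ-unique; ⁻¹-∙-comm; ∙-cancelˡ)
  open import Algebra.Properties.CommutativeSemigroup +-commutativeSemigroup using (interchange)
  open import Algebra.Properties.Ring ring using ([y-z]x≈yx-zx)

  lines-difference : ∀ c c' s s' z →
    (c · z +F s) +F -F (c' · z +F s') ≡ (c +F -F c') · z +F (s +F -F s')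
  lines-difference c c' s s' z = begin
    (c · z +F s) +F -F (c' · z +F s')         ≡⟨ cong (_+F_ (c · z +F s)) (⁻¹-∙-comm (c' · z) s') ⟨
    (c · z +F s) +F (-F (c' · z) +F -F s')    ≡⟨ interchange (c · z) s (-F (c' · z)) (-F s') ⟩
    (c · z +F -F (c' · z)) +F (s +F -F s')    ≡⟨ cong (_+F (s +F -F s')) ([y-z]x≈yx-zx z c c') ⟨
    (c +F -F c') · z +F (s +F -F s')          ∎
    where open ≡-Reasoning

  lines-meet⇔ : ∀ c c' s s' z →
    c · z +F s ≡ c' · z +F s' ⇔ (c +F -F c') · z ≡ -F (s +F -F s')
  lines-meet⇔ c c' s s' z = mk⇔
    (λ meet → inverseˡ-unique _ _ (trans (sym (lines-difference c c' s s' z)) (x≈y⇒x∙y⁻¹≈ε meet)))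
    (λ eq → x∙y⁻¹≈ε⇒x≈y _ _ (trans (lines-difference c c' s s' z)
                                   (trans (cong (_+F (s +F -F s')) eq) (-‿inverseˡ _))))

  divide⇔ : ∀ {e w z t} → e · w ≡ 1# → e · z ≡ t ⇔ z ≡ w · t
  divide⇔ {e} {w} {z} {t} ew≡1 = mk⇔
    (λ ez≡t → begin
      z           ≡⟨ *-identityˡ z ⟨
      1# · z      ≡⟨ cong (_· z) (trans (sym ew≡1) (*-comm e w)) ⟩
      w · e · z   ≡⟨ *-assoc w e z ⟩
      w · (e · z) ≡⟨ cong (w ·_) ez≡t ⟩
      w · t       ∎)
    (λ { refl → begin
      e · (w · t) ≡⟨ *-assoc e w t ⟨
      e · w · t   ≡⟨ cong (_· t) ew≡1 ⟩
      1# · t      ≡⟨ *-identityˡ t ⟩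
      t           ∎ })
    where open ≡-Reasoning

  lines-meet-once : ∀ {c c'} → c ≢ c' → ∀ s s' →
                    ∑[ z ← elements ] δ _≟_ (c · z +F s) (c' · z +F s') ≡ 1ℤ
  lines-meet-once {c} {c'} c≢c' s s' = begin
    ∑[ z ← elements ] δ _≟_ (c · z +F s) (c' · z +F s') ≡⟨ ∑-cong elements meets-at-z₀ ⟩
    ∑[ z ← elements ] (δ _≟_ z₀ z * 1ℤ)                  ≡⟨ ∑-elements-δ z₀ (λ _ → 1ℤ) ⟩
    1ℤ                                                   ∎
    where
    open ≡-Reasoning
    slope≢0 : c +F -F c' ≢ 0#
    slope≢0 eq = c≢c' (x∙y⁻¹≈ε⇒x≈y c c' eq)
    w z₀ : Carrier
    w = proj₁ (inverse (c +F -F c') slope≢0)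
    z₀ = w · -F (s +F -F s')
    meet⇔z₀ : ∀ z → c · z +F s ≡ c' · z +F s' ⇔ z₀ ≡ z
    meet⇔z₀ z = mk⇔ sym sym ⇔-∘ (divide⇔ (proj₂ (inverse (c +F -F c') slope≢0))
                                 ⇔-∘ lines-meet⇔ c c' s s' z)
    meets-at-z₀ : ∀ z → δ _≟_ (c · z +F s) (c' · z +F s') ≡ δ _≟_ z₀ z * 1ℤ
    meets-at-z₀ z = trans (𝟙-cong (meet⇔z₀ z) _ (z₀ ≟ z))
                          (sym (ℤ.*-identityʳ _))

  ΣF-cong : ∀ m {f g : Fin m → Carrier} → (∀ j → f j ≡ g j) → ΣF 𝔽 m f ≡ ΣF 𝔽 m g
  ΣF-cong zero    f≗g = refl
  ΣF-cong (suc m) f≗g = cong₂ _+F_ (f≗g zero) (ΣF-cong m (λ j → f≗g (suc j)))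

  affine : ∀ {n} → Vec Carrier (suc n) → Vec Carrier n → Carrier
  affine {n} v x = ΣF 𝔽 n (λ j → lookup v (inject₁ j) · lookup x j) +F lookup v (fromℕ n)

  affine-∷ : ∀ {n} c (v : Vec Carrier (suc n)) z x → affine (c ∷ v) (z ∷ x) ≡ c · z +F affine v x
  affine-∷ c v z x = +-assoc (c · z) _ _

  affineMap : ∀ {n d} → Vec (Vec Carrier (suc n)) d → Vec Carrier n → Vec Carrier d
  affineMap a x = Vec.map (λ v → affine v x) a

  affine-agreements-≢ : ∀ {n} {v v' : Vec Carrier (suc n)} → v ≢ v' →
    Q * ∑[ x ← vectors n ] δ _≟_ (affine v x) (affine v' x) ≤ Q ^ n
  affine-agreements-≢ {zero} {β ∷ []} {β' ∷ []} v≢v' =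
    ℤ.≤-trans (ℤ.≤-reflexive no-agreement) (+≤+ ℕ.z≤n)
    where
    no-agreement : Q * (δ _≟_ (0# +F β) (0# +F β') + 0ℤ) ≡ 0ℤ
    no-agreement = trans (cong (λ t → Q * (t + 0ℤ)) (δ-≢ _≟_ (v≢v' ∘ cong (_∷ []) ∘ ∙-cancelˡ 0# β β')))
                         (ℤ.*-zeroʳ Q)
  affine-agreements-≢ {suc n} {c ∷ v} {c' ∷ v'} v≢v' with c ≟ c'
  ... | yes refl = begin
    Q * ∑ (vectors (suc n)) (λ x → δ _≟_ (affine (c ∷ v) x) (affine (c ∷ v') x))
      ≡⟨ cong (Q *_) (∑-vectors-∷ n _) ⟩
    Q * ∑[ z ← elements ] ∑[ x ← vectors n ]
          δ _≟_ (affine (c ∷ v) (z ∷ x)) (affine (c ∷ v') (z ∷ x))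
      ≡⟨ cong (Q *_) (∑-cong elements (λ z → ∑-cong (vectors n) (λ x → 𝟙-cong (cancel z x) _ _))) ⟩
    Q * ∑[ z ← elements ] K
      ≡⟨ cong (Q *_) (trans (∑-elements-const K) (ℤ.*-comm K Q)) ⟩
    Q * (Q * K)
      ≤⟨ ℤ.*-monoˡ-≤-nonNeg Q (affine-agreements-≢ (λ v≡v' → v≢v' (cong (c ∷_) v≡v'))) ⟩
    Q * Q ^ n ∎
    where
    open ℤ.≤-Reasoning
    K : ℤ
    K = ∑[ x ← vectors n ] δ _≟_ (affine v x) (affine v' x)
    cancel : ∀ z x → affine (c ∷ v) (z ∷ x) ≡ affine (c ∷ v') (z ∷ x) ⇔ affine v x ≡ affine v' x
    cancel z x = mk⇔
      (λ eq → ∙-cancelˡ (c · z) _ _ (trans (sym (affine-∷ c v z x)) (trans eq (affine-∷ c v' z x))))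
      (λ eq → trans (affine-∷ c v z x) (trans (cong (_+F_ (c · z)) eq) (sym (affine-∷ c v' z x))))
  ... | no c≢c' = ℤ.≤-reflexive (cong (Q *_) (begin
    ∑ (vectors (suc n)) (λ x → δ _≟_ (affine (c ∷ v) x) (affine (c' ∷ v') x))
      ≡⟨ ∑-vectors-∷ n _ ⟩
    ∑[ z ← elements ] ∑[ x ← vectors n ] δ _≟_ (affine (c ∷ v) (z ∷ x)) (affine (c' ∷ v') (z ∷ x))
      ≡⟨ ∑-cong elements (λ z → ∑-cong (vectors n) (λ x →
           cong₂ (δ _≟_) (affine-∷ c v z x) (affine-∷ c' v' z x))) ⟩
    ∑[ z ← elements ] ∑[ x ← vectors n ] δ _≟_ (c · z +F affine v x) (c' · z +F affine v' x)
      ≡⟨ ∑-swap elements (vectors n) _ ⟩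
    ∑[ x ← vectors n ] ∑[ z ← elements ] δ _≟_ (c · z +F affine v x) (c' · z +F affine v' x)
      ≡⟨ ∑-cong (vectors n) (λ x → lines-meet-once c≢c' (affine v x) (affine v' x)) ⟩
    ∑[ x ← vectors n ] 1ℤ
      ≡⟨ trans (∑-vectors-const n 1ℤ) (ℤ.*-identityˡ _) ⟩
    Q ^ n ∎))
    where open ≡-Reasoning

  affineMap-agreements-≢ : ∀ {n d} {a a' : Vec (Vec Carrier (suc n)) d} → a ≢ a' →
    Q * ∑[ x ← vectors n ] δ _≟ᵥ_ (affineMap a x) (affineMap a' x) ≤ Q ^ n
  affineMap-agreements-≢ {a = []}    {[]}      a≢a' = contradiction refl a≢a'
  affineMap-agreements-≢ {n} {a = v ∷ a} {v' ∷ a'} a≢a' with v ≟ᵥ v'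
  ... | yes refl = ℤ.≤-trans (ℤ.≤-reflexive (cong (Q *_) (∑-cong (vectors n) drop-first-row)))
                             (affineMap-agreements-≢ (λ a≡a' → a≢a' (cong (v ∷_) a≡a')))
    where
    drop-first-row : ∀ x → δ _≟ᵥ_ (affineMap (v ∷ a) x) (affineMap (v ∷ a') x)
                         ≡ δ _≟ᵥ_ (affineMap a x) (affineMap a' x)
    drop-first-row x = begin
      δ _≟ᵥ_ (affine v x ∷ affineMap a x) (affine v x ∷ affineMap a' x)
        ≡⟨ δ-∷ _≟_ (affine v x) _ _ _ ⟩
      δ _≟_ (affine v x) (affine v x) * δ _≟ᵥ_ (affineMap a x) (affineMap a' x)
        ≡⟨ cong (_* δ _≟ᵥ_ (affineMap a x) (affineMap a' x)) (δ-refl _≟_ (affine v x)) ⟩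
      1ℤ * δ _≟ᵥ_ (affineMap a x) (affineMap a' x) ≡⟨ ℤ.*-identityˡ _ ⟩
      δ _≟ᵥ_ (affineMap a x) (affineMap a' x) ∎
      where open ≡-Reasoning
  ... | no v≢v' = ℤ.≤-trans (ℤ.*-monoˡ-≤-nonNeg Q (∑-mono-≤ (vectors n) first-row))
                            (affine-agreements-≢ v≢v')
    where
    first-row : ∀ x → δ _≟ᵥ_ (affineMap (v ∷ a) x) (affineMap (v' ∷ a') x)
                    ≤ δ _≟_ (affine v x) (affine v' x)
    first-row x = δ-∷-≤ _≟_ (affine v x) (affine v' x) (affineMap a x) (affineMap a' x)

  module Flats (n d : ℕ) where

    incident : Vec Carrier (n ℕ.+ d) → Vec (Vec Carrier (suc n)) d → ℤ
    incident u a = 𝟙 (onFlat? 𝔽 n d u a)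

    incident-++ : ∀ x y a → incident (x Vec.++ y) a ≡ δ _≟ᵥ_ (affineMap a x) y
    incident-++ x y a = 𝟙-cong (mk⇔ onFlat⇒graph graph⇒onFlat) _ _
      where
      row : ∀ i → ΣF 𝔽 n (λ j → lookup (lookup a i) (inject₁ j) · lookup (x Vec.++ y) (j ↑ˡ d))
                    +F lookup (lookup a i) (fromℕ n)
                ≡ lookup (affineMap a x) i
      row i = trans (cong (_+F lookup (lookup a i) (fromℕ n)) (ΣF-cong n (λ j →
                       cong (lookup (lookup a i) (inject₁ j) ·_) (Vec.lookup-++ˡ x y j))))
                    (sym (Vec.lookup-map i (λ v → affine v x) a))
      onFlat⇒graph : OnFlat 𝔽 n d (x Vec.++ y) a → affineMap a x ≡ y
      onFlat⇒graph on = Pointwise-≡⇒≡ (ext λ i →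
        sym (trans (sym (Vec.lookup-++ʳ x y i)) (trans (on i) (row i))))
      graph⇒onFlat : affineMap a x ≡ y → OnFlat 𝔽 n d (x Vec.++ y) a
      graph⇒onFlat refl i = trans (Vec.lookup-++ʳ x (affineMap a x) i) (sym (row i))

    _≟ₐ_ : DecidableEquality (Vec (Vec Carrier (suc n)) d)
    _≟ₐ_ = Vec.≡-dec _≟ᵥ_

    flat-size : ∀ a → ∑[ u ← vectors (n ℕ.+ d) ] incident u a ≡ Q ^ n
    flat-size a = begin
      ∑[ u ← vectors (n ℕ.+ d) ] incident u a                   ≡⟨ ∑-vectors-++ n d _ ⟩
      ∑[ x ← vectors n ] ∑[ y ← vectors d ] incident (x Vec.++ y) a
        ≡⟨ ∑-cong (vectors n) (λ x → trans (∑-cong (vectors d) (λ y → incident-++ x y a))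
                                           (∑-vectors-δ₁ d (affineMap a x))) ⟩
      ∑[ x ← vectors n ] 1ℤ                                      ≡⟨ ∑-vectors-const n 1ℤ ⟩
      1ℤ * Q ^ n                                                 ≡⟨ ℤ.*-identityˡ _ ⟩
      Q ^ n                                                      ∎
      where open ≡-Reasoning

    flat-intersection : ∀ a a' → ∑[ u ← vectors (n ℕ.+ d) ] (incident u a * incident u a')
                               ≡ ∑[ x ← vectors n ] δ _≟ᵥ_ (affineMap a x) (affineMap a' x)
    flat-intersection a a' = begin
      ∑[ u ← vectors (n ℕ.+ d) ] (incident u a * incident u a')
        ≡⟨ ∑-vectors-++ n d _ ⟩
      ∑[ x ← vectors n ] ∑[ y ← vectors d ] (incident (x Vec.++ y) a * incident (x Vec.++ y) a')
        ≡⟨ ∑-cong (vectors n) (λ x → ∑-cong (vectors d) (λ y →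
             cong₂ _*_ (incident-++ x y a) (incident-++ x y a'))) ⟩
      ∑[ x ← vectors n ] ∑[ y ← vectors d ] (δ _≟ᵥ_ (affineMap a x) y * δ _≟ᵥ_ (affineMap a' x) y)
        ≡⟨ ∑-cong (vectors n) (λ x → ∑-vectors-δ d (affineMap a x) (δ _≟ᵥ_ (affineMap a' x))) ⟩
      ∑[ x ← vectors n ] δ _≟ᵥ_ (affineMap a' x) (affineMap a x)
        ≡⟨ ∑-cong (vectors n) (λ x → δ-sym _≟ᵥ_ (affineMap a' x) (affineMap a x)) ⟩
      ∑[ x ← vectors n ] δ _≟ᵥ_ (affineMap a x) (affineMap a' x) ∎
      where open ≡-Reasoning

    flat-intersection-bound : ∀ a a' → Q * ∑[ u ← vectors (n ℕ.+ d) ] (incident u a * incident u a')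
                                       ≤ Q ^ n + (Q ^ suc n - Q ^ n) * δ _≟ₐ_ a a'
    flat-intersection-bound a a' with a ≟ₐ a'
    ... | yes refl = ℤ.≤-reflexive (begin
      Q * ∑[ u ← vectors (n ℕ.+ d) ] (incident u a * incident u a)
        ≡⟨ cong (Q *_) (flat-intersection a a) ⟩
      Q * ∑[ x ← vectors n ] δ _≟ᵥ_ (affineMap a x) (affineMap a x)
        ≡⟨ cong (Q *_) (trans (∑-cong (vectors n) (λ x → δ-refl _≟ᵥ_ (affineMap a x)))
                              (∑-vectors-const n 1ℤ)) ⟩
      Q * (1ℤ * Q ^ n)
        ≡⟨ rearrange Q (Q ^ n) ⟩
      Q ^ n + (Q * Q ^ n - Q ^ n) * 1ℤ ∎)
      where
      open ≡-Reasoning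
      rearrange : ∀ Q X → Q * (1ℤ * X) ≡ X + (Q * X - X) * 1ℤ
      rearrange = solve-∀
    ... | no a≢a' = begin
      Q * ∑[ u ← vectors (n ℕ.+ d) ] (incident u a * incident u a')
        ≡⟨ cong (Q *_) (flat-intersection a a') ⟩
      Q * ∑[ x ← vectors n ] δ _≟ᵥ_ (affineMap a x) (affineMap a' x)
        ≤⟨ affineMap-agreements-≢ a≢a' ⟩
      Q ^ n
        ≡⟨ ℤ.+-identityʳ (Q ^ n) ⟨
      Q ^ n + 0ℤ
        ≡⟨ cong (_+_ (Q ^ n)) (ℤ.*-zeroʳ (Q ^ suc n - Q ^ n)) ⟨
      Q ^ n + (Q ^ suc n - Q ^ n) * 0ℤ ∎
      where open ℤ.≤-Reasoning

    base : Vec Carrier (n ℕ.+ d) → Vec Carrier n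
    base = Vec.take n

    ∑-base : ∀ (g : Vec Carrier n → ℤ) →
             ∑[ u ← vectors (n ℕ.+ d) ] g (base u) ≡ Q ^ d * ∑[ x ← vectors n ] g x
    ∑-base g = begin
      ∑[ u ← vectors (n ℕ.+ d) ] g (base u)                     ≡⟨ ∑-vectors-++ n d _ ⟩
      ∑[ x ← vectors n ] ∑[ y ← vectors d ] g (base (x Vec.++ y))
        ≡⟨ ∑-cong (vectors n) (λ x → trans (∑-cong (vectors d) (λ y → cong g (take-++ x y)))
                                           (∑-vectors-const d (g x))) ⟩
      ∑[ x ← vectors n ] (g x * Q ^ d)                           ≡⟨ *-distribʳ-∑ (Q ^ d) (vectors n) g ⟨
      ∑[ x ← vectors n ] g x * Q ^ d                             ≡⟨ ℤ.*-comm _ (Q ^ d) ⟩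
      Q ^ d * ∑[ x ← vectors n ] g x                             ∎
      where open ≡-Reasoning

    fibre-size : ∀ x → ∑[ u ← vectors (n ℕ.+ d) ] δ _≟ᵥ_ x (base u) ≡ Q ^ d
    fibre-size x = trans (∑-base (δ _≟ᵥ_ x))
                         (trans (cong (Q ^ d *_) (∑-vectors-δ₁ n x)) (ℤ.*-identityʳ _))

    fibres-intersection : ∀ x x' → ∑[ u ← vectors (n ℕ.+ d) ] (δ _≟ᵥ_ x (base u) * δ _≟ᵥ_ x' (base u))
                                   ≡ Q ^ d * δ _≟ᵥ_ x' x
    fibres-intersection x x' = trans (∑-base (λ z → δ _≟ᵥ_ x z * δ _≟ᵥ_ x' z))
                                     (cong (Q ^ d *_) (∑-vectors-δ n x (δ _≟ᵥ_ x')))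

    fibre-meets-flat-once : ∀ x a →
      ∑[ u ← vectors (n ℕ.+ d) ] (δ _≟ᵥ_ x (base u) * incident u a) ≡ 1ℤ
    fibre-meets-flat-once x a = begin
      ∑[ u ← vectors (n ℕ.+ d) ] (δ _≟ᵥ_ x (base u) * incident u a)
        ≡⟨ ∑-vectors-++ n d _ ⟩
      ∑[ z ← vectors n ] ∑[ y ← vectors d ] (δ _≟ᵥ_ x (base (z Vec.++ y)) * incident (z Vec.++ y) a)
        ≡⟨ ∑-cong (vectors n) (λ z → ∑-cong (vectors d) (λ y →
             cong₂ _*_ (cong (δ _≟ᵥ_ x) (take-++ z y)) (incident-++ z y a))) ⟩
      ∑[ z ← vectors n ] ∑[ y ← vectors d ] (δ _≟ᵥ_ x z * δ _≟ᵥ_ (affineMap a z) y)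
        ≡⟨ ∑-cong (vectors n) (λ z → *-distribˡ-∑ (δ _≟ᵥ_ x z) (vectors d) _) ⟨
      ∑[ z ← vectors n ] (δ _≟ᵥ_ x z * ∑[ y ← vectors d ] δ _≟ᵥ_ (affineMap a z) y)
        ≡⟨ ∑-cong (vectors n) (λ z → cong (δ _≟ᵥ_ x z *_) (∑-vectors-δ₁ d (affineMap a z))) ⟩
      ∑[ z ← vectors n ] (δ _≟ᵥ_ x z * 1ℤ)
        ≡⟨ ∑-vectors-δ n x (λ _ → 1ℤ) ⟩
      1ℤ ∎
      where open ≡-Reasoning

-- Incidences

module Incidences {q : ℕ} (𝔽 : FiniteField q) {n d : ℕ}
  (P : List (Vec (FiniteField.Carrier 𝔽) (n ℕ.+ d))) (P-unique : Unique P)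
  (F : List (Vec (Vec (FiniteField.Carrier 𝔽) (suc n)) d)) (F-unique : Unique F) where

  open FiniteField 𝔽 using (Carrier)
  open AffineSpace 𝔽
  open Flats n d

  𝔸 : List (Vec Carrier (n ℕ.+ d))
  𝔸 = vectors (n ℕ.+ d)

  X Y p f I : ℤ
  X = Q ^ n
  Y = Q ^ d
  p = + length P
  f = + length F
  I = + incidences 𝔽 n d P F

  𝟙ᴾ : Vec Carrier (n ℕ.+ d) → ℤ
  𝟙ᴾ u = ∑[ v ← P ] δ _≟ᵥ_ u v

  flatsThrough : Vec Carrier (n ℕ.+ d) → ℤ
  flatsThrough u = ∑[ a ← F ] incident u a

  flatExcess : Vec Carrier (n ℕ.+ d) → ℤ
  flatExcess u = Y * flatsThrough u - f

  R E : ℤ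
  R = ∑[ u ← 𝔸 ] (flatsThrough u * flatsThrough u)
  E = ∑[ u ← 𝔸 ] (flatExcess u * flatExcess u)

  I≡∑flatsThrough : I ≡ ∑[ v ← P ] flatsThrough v
  I≡∑flatsThrough = trans (+-sum-map _ P) (∑-cong P (λ v → +-length-filter (onFlat? 𝔽 n d v) F))

  ∑-𝟙ᴾ : ∀ g → ∑[ u ← 𝔸 ] (𝟙ᴾ u * g u) ≡ ∑[ v ← P ] g v
  ∑-𝟙ᴾ g = begin
    ∑[ u ← 𝔸 ] (𝟙ᴾ u * g u)
      ≡⟨ ∑-cong 𝔸 (λ u → *-distribʳ-∑ (g u) P (δ _≟ᵥ_ u)) ⟩
    ∑[ u ← 𝔸 ] ∑[ v ← P ] (δ _≟ᵥ_ u v * g u)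
      ≡⟨ ∑-swap 𝔸 P _ ⟩
    ∑[ v ← P ] ∑[ u ← 𝔸 ] (δ _≟ᵥ_ u v * g u)
      ≡⟨ ∑-cong P (λ v → ∑-cong 𝔸 (λ u → cong (_* g u) (δ-sym _≟ᵥ_ u v))) ⟩
    ∑[ v ← P ] ∑[ u ← 𝔸 ] (δ _≟ᵥ_ v u * g u)
      ≡⟨ ∑-cong P (λ v → ∑-vectors-δ (n ℕ.+ d) v g) ⟩
    ∑[ v ← P ] g v ∎
    where open ≡-Reasoning

  ∑-𝟙ᴾ² : ∑[ u ← 𝔸 ] (𝟙ᴾ u * 𝟙ᴾ u) ≡ p
  ∑-𝟙ᴾ² = trans (∑-𝟙ᴾ 𝟙ᴾ) (∑-∑-δ-unique _≟ᵥ_ P-unique)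

  ∑-flatsThrough : ∑[ u ← 𝔸 ] flatsThrough u ≡ X * f
  ∑-flatsThrough = trans (∑-swap 𝔸 F incident) (trans (∑-cong F flat-size) (∑-const F X))

  ∑-𝔸-1 : ∑[ u ← 𝔸 ] 1ℤ ≡ X * Y
  ∑-𝔸-1 = trans (∑-vectors-const (n ℕ.+ d) 1ℤ) (trans (ℤ.*-identityˡ _) (ℤ.^-distribˡ-+-* Q n d))

  ∑-flatsThrough² : R
                  ≡ ∑[ a ← F ] ∑[ a' ← F ] ∑[ u ← 𝔸 ] (incident u a * incident u a')
  ∑-flatsThrough² = begin
    R
      ≡⟨ ∑-cong 𝔸 (λ u → ∑-∑-* F F (incident u) (incident u)) ⟨
    ∑[ u ← 𝔸 ] ∑[ a ← F ] ∑[ a' ← F ] (incident u a * incident u a')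
      ≡⟨ ∑-swap 𝔸 F _ ⟩
    ∑[ a ← F ] ∑[ u ← 𝔸 ] ∑[ a' ← F ] (incident u a * incident u a')
      ≡⟨ ∑-cong F (λ a → ∑-swap 𝔸 F _) ⟩
    ∑[ a ← F ] ∑[ a' ← F ] ∑[ u ← 𝔸 ] (incident u a * incident u a') ∎
    where open ≡-Reasoning

  second-moment : Q * R ≤ X * f * (f + Q - 1ℤ)
  second-moment = begin
    Q * R
      ≡⟨ cong (Q *_) ∑-flatsThrough² ⟩
    Q * ∑[ a ← F ] ∑[ a' ← F ] ∑[ u ← 𝔸 ] (incident u a * incident u a')
      ≡⟨ trans (*-distribˡ-∑ Q F _) (∑-cong F (λ a → *-distribˡ-∑ Q F _)) ⟩
    ∑[ a ← F ] ∑[ a' ← F ] (Q * ∑[ u ← 𝔸 ] (incident u a * incident u a'))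
      ≤⟨ ∑-mono-≤ F (λ a → ∑-mono-≤ F (λ a' → flat-intersection-bound a a')) ⟩
    ∑[ a ← F ] ∑[ a' ← F ] (X + (Q * X - X) * δ _≟ₐ_ a a')
      ≡⟨ ∑-∑-distrib-+ F F (λ _ _ → X) (λ a a' → (Q * X - X) * δ _≟ₐ_ a a') ⟩
    ∑[ a ← F ] ∑[ a' ← F ] X + ∑[ a ← F ] ∑[ a' ← F ] ((Q * X - X) * δ _≟ₐ_ a a')
      ≡⟨ cong₂ _+_ (trans (∑-cong F (λ _ → ∑-const F X)) (∑-const F (X * f)))
                   (sym (trans (*-distribˡ-∑ (Q * X - X) F _)
                               (∑-cong F (λ a → *-distribˡ-∑ (Q * X - X) F _)))) ⟩
    X * f * f + (Q * X - X) * ∑[ a ← F ] ∑[ a' ← F ] δ _≟ₐ_ a a'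
      ≡⟨ cong (λ t → X * f * f + (Q * X - X) * t) (∑-∑-δ-unique _≟ₐ_ F-unique) ⟩
    X * f * f + (Q * X - X) * f
      ≡⟨ factor X f Q ⟩
    X * f * (f + Q - 1ℤ) ∎
    where
    open ℤ.≤-Reasoning
    factor : ∀ X f Q → X * f * f + (Q * X - X) * f ≡ X * f * (f + Q - 1ℤ)
    factor = solve-∀

  E≡YYR-XYff : E ≡ Y * Y * R - X * Y * f * f
  E≡YYR-XYff = begin
    E
      ≡⟨ ∑-cong 𝔸 (λ u → expand Y (flatsThrough u) f) ⟩
    ∑[ u ← 𝔸 ] (Y * Y * (flatsThrough u * flatsThrough u) + - (+ 2 * Y * f) * flatsThrough u + f * f * 1ℤ)
      ≡⟨ ∑-linear₃ 𝔸 (Y * Y) (- (+ 2 * Y * f)) (f * f)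
                   (λ u → flatsThrough u * flatsThrough u) flatsThrough (λ _ → 1ℤ) ⟩
    Y * Y * R + - (+ 2 * Y * f) * ∑[ u ← 𝔸 ] flatsThrough u + f * f * ∑[ u ← 𝔸 ] 1ℤ
      ≡⟨ cong₂ (λ s t → Y * Y * R + - (+ 2 * Y * f) * s + f * f * t)
               ∑-flatsThrough ∑-𝔸-1 ⟩
    Y * Y * R + - (+ 2 * Y * f) * (X * f) + f * f * (X * Y)
      ≡⟨ collect Y X f R ⟩
    Y * Y * R - X * Y * f * f ∎
    where
    open ≡-Reasoning
    expand : ∀ Y r f → (Y * r - f) * (Y * r - f) ≡ Y * Y * (r * r) + - (+ 2 * Y * f) * r + f * f * 1ℤ
    expand = solve-∀
    collect : ∀ Y X f R → Y * Y * R + - (+ 2 * Y * f) * (X * f) + f * f * (X * Y) ≡ Y * Y * R - X * Y * f * f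
    collect = solve-∀

  flatExcess-bound : Q * E ≤ Y * Y * (X * f * (f + Q - 1ℤ)) - Q * (X * Y * f * f)
  flatExcess-bound = begin
    Q * E
      ≡⟨ cong (Q *_) E≡YYR-XYff ⟩
    Q * (Y * Y * R - X * Y * f * f)
      ≡⟨ distribute Q Y X f R ⟩
    Y * Y * (Q * R) - Q * (X * Y * f * f)
      ≤⟨ ℤ.+-monoˡ-≤ (- (Q * (X * Y * f * f)))
           (ℤ.*-monoˡ-≤-nonNeg (Y * Y) {{nonNegative (square-nonNeg Y)}} second-moment) ⟩
    Y * Y * (X * f * (f + Q - 1ℤ)) - Q * (X * Y * f * f) ∎
    where
    open ℤ.≤-Reasoning
    distribute : ∀ Q Y X f R → Q * (Y * Y * R - X * Y * f * f) ≡ Y * Y * (Q * R) - Q * (X * Y * f * f)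
    distribute = solve-∀

  ∑-𝟙ᴾ-flatExcess : ∑[ u ← 𝔸 ] (𝟙ᴾ u * flatExcess u) ≡ Y * I - p * f
  ∑-𝟙ᴾ-flatExcess = begin
    ∑[ u ← 𝔸 ] (𝟙ᴾ u * flatExcess u)
      ≡⟨ ∑-𝟙ᴾ flatExcess ⟩
    ∑[ v ← P ] (Y * flatsThrough v - f)
      ≡⟨ ∑-distrib-- P (λ v → Y * flatsThrough v) (λ _ → f) ⟩
    ∑[ v ← P ] (Y * flatsThrough v) - ∑[ v ← P ] f
      ≡⟨ cong₂ _-_ (*-distribˡ-∑ Y P flatsThrough) (sym (∑-const P f)) ⟨
    Y * ∑[ v ← P ] flatsThrough v - f * p
      ≡⟨ cong₂ (λ s t → Y * s - t) I≡∑flatsThrough (ℤ.*-comm p f) ⟨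
    Y * I - p * f ∎
    where open ≡-Reasoning

  incidence-cauchy-schwarz : (Y * I - p * f) * (Y * I - p * f) ≤ p * E
  incidence-cauchy-schwarz =
    subst₂ _≤_ (cong₂ _*_ ∑-𝟙ᴾ-flatExcess ∑-𝟙ᴾ-flatExcess)
               (cong (_* E) ∑-𝟙ᴾ²)
               (cauchy-schwarz 𝔸 𝟙ᴾ flatExcess)

  p≥0 : 0ℤ ≤ p
  p≥0 = +≤+ ℕ.z≤n

  f≥0 : 0ℤ ≤ f
  f≥0 = +≤+ ℕ.z≤n

  X≥0 : 0ℤ ≤ X
  X≥0 = ^-nonNeg Q≥0 n

  Y≥0 : 0ℤ ≤ Y
  Y≥0 = ^-nonNeg Q≥0 d

  incidence-bound : Q * ((Y * I - p * f) * (Y * I - p * f)) ≤ Y * Y * X * p * f * (Q + f)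
  incidence-bound = begin
    Q * ((Y * I - p * f) * (Y * I - p * f))
      ≤⟨ ℤ.*-monoˡ-≤-nonNeg Q incidence-cauchy-schwarz ⟩
    Q * (p * E)
      ≡⟨ ℤ.*-assoc Q p E ⟨
    Q * p * E
      ≡⟨ cong (_* E) (ℤ.*-comm Q p) ⟩
    p * Q * E
      ≡⟨ ℤ.*-assoc p Q E ⟩
    p * (Q * E)
      ≤⟨ ℤ.*-monoˡ-≤-nonNeg p flatExcess-bound ⟩
    p * (Y * Y * (X * f * (f + Q - 1ℤ)) - Q * (X * Y * f * f))
      ≡⟨ rearrange Q X Y p f ⟩
    Y * Y * X * p * f * (Q + f) - p * X * Y * f * (Y + Q * f)
      ≤⟨ ℤ.i-j≤i _ _ {{nonNegative slack≥0}} ⟩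
    Y * Y * X * p * f * (Q + f) ∎
    where
    open ℤ.≤-Reasoning
    rearrange : ∀ Q X Y p f → p * (Y * Y * (X * f * (f + Q - 1ℤ)) - Q * (X * Y * f * f))
                            ≡ Y * Y * X * p * f * (Q + f) - p * X * Y * f * (Y + Q * f)
    rearrange = solve-∀
    slack≥0 : 0ℤ ≤ p * X * Y * f * (Y + Q * f)
    slack≥0 = *-nonNeg (*-nonNeg (*-nonNeg (*-nonNeg p≥0 X≥0) Y≥0) f≥0)
                       (ℤ.+-mono-≤ Y≥0 (*-nonNeg Q≥0 f≥0))

  fibreCount : Vec Carrier (n ℕ.+ d) → ℤ
  fibreCount u = ∑[ v ← P ] δ _≟ᵥ_ (base v) (base u)

  pointExcess : Vec Carrier (n ℕ.+ d) → ℤ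
  pointExcess u = Y * 𝟙ᴾ u - fibreCount u

  S : ℤ
  S = ∑[ v ← P ] fibreCount v

  ∑-fibreCount : ∑[ u ← 𝔸 ] fibreCount u ≡ Y * p
  ∑-fibreCount = trans (∑-swap 𝔸 P _) (trans (∑-cong P (λ v → fibre-size (base v))) (∑-const P Y))

  ∑-fibreCount-flatsThrough : ∑[ u ← 𝔸 ] (fibreCount u * flatsThrough u) ≡ p * f
  ∑-fibreCount-flatsThrough = begin
    ∑[ u ← 𝔸 ] (fibreCount u * flatsThrough u)
      ≡⟨ ∑-cong 𝔸 (λ u → ∑-∑-* P F _ _) ⟨
    ∑[ u ← 𝔸 ] ∑[ v ← P ] ∑[ a ← F ] (δ _≟ᵥ_ (base v) (base u) * incident u a)
      ≡⟨ trans (∑-swap 𝔸 P _) (∑-cong P (λ v → ∑-swap 𝔸 F _)) ⟩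
    ∑[ v ← P ] ∑[ a ← F ] ∑[ u ← 𝔸 ] (δ _≟ᵥ_ (base v) (base u) * incident u a)
      ≡⟨ ∑-cong P (λ v → ∑-cong F (λ a → fibre-meets-flat-once (base v) a)) ⟩
    ∑[ v ← P ] ∑[ a ← F ] 1ℤ
      ≡⟨ trans (∑-cong P (λ _ → trans (∑-const F 1ℤ) (ℤ.*-identityˡ f)))
               (trans (∑-const P f) (ℤ.*-comm f p)) ⟩
    p * f ∎
    where open ≡-Reasoning

  ∑-fibreCount² : ∑[ u ← 𝔸 ] (fibreCount u * fibreCount u) ≡ Y * S
  ∑-fibreCount² = begin
    ∑[ u ← 𝔸 ] (fibreCount u * fibreCount u)
      ≡⟨ ∑-cong 𝔸 (λ u → ∑-∑-* P P _ _) ⟨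
    ∑[ u ← 𝔸 ] ∑[ v ← P ] ∑[ v' ← P ] (δ _≟ᵥ_ (base v) (base u) * δ _≟ᵥ_ (base v') (base u))
      ≡⟨ trans (∑-swap 𝔸 P _) (∑-cong P (λ v → ∑-swap 𝔸 P _)) ⟩
    ∑[ v ← P ] ∑[ v' ← P ] ∑[ u ← 𝔸 ] (δ _≟ᵥ_ (base v) (base u) * δ _≟ᵥ_ (base v') (base u))
      ≡⟨ ∑-cong P (λ v → ∑-cong P (λ v' → fibres-intersection (base v) (base v'))) ⟩
    ∑[ v ← P ] ∑[ v' ← P ] (Y * δ _≟ᵥ_ (base v') (base v))
      ≡⟨ trans (*-distribˡ-∑ Y P fibreCount) (∑-cong P (λ v → *-distribˡ-∑ Y P _)) ⟨
    Y * S ∎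
    where open ≡-Reasoning

  p≤S : p ≤ S
  p≤S = begin
    p                         ≡⟨ ℤ.*-identityˡ p ⟨
    1ℤ * p                    ≡⟨ ∑-const P 1ℤ ⟨
    ∑[ v ← P ] 1ℤ             ≤⟨ ∑-mono-≤-∈ P own-fibre ⟩
    ∑[ v ← P ] fibreCount v   ∎
    where
    open ℤ.≤-Reasoning
    own-fibre : ∀ {v} → v ∈ P → 1ℤ ≤ fibreCount v
    own-fibre {v} v∈P = ℤ.≤-trans (ℤ.≤-reflexive (sym (δ-refl _≟ᵥ_ (base v))))
                                  (∈⇒≤∑ (λ v' → δ-nonNeg _≟ᵥ_ (base v') (base v)) v∈P)

  ∑-fibreCount-flatExcess : ∑[ u ← 𝔸 ] (fibreCount u * flatExcess u) ≡ 0ℤ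
  ∑-fibreCount-flatExcess = begin
    ∑[ u ← 𝔸 ] (fibreCount u * flatExcess u)
      ≡⟨ ∑-cong 𝔸 (λ u → expand Y f (fibreCount u) (flatsThrough u)) ⟩
    ∑[ u ← 𝔸 ] (Y * (fibreCount u * flatsThrough u) + - f * fibreCount u)
      ≡⟨ ∑-linear 𝔸 Y (- f) (λ u → fibreCount u * flatsThrough u) fibreCount ⟩
    Y * ∑[ u ← 𝔸 ] (fibreCount u * flatsThrough u) + - f * ∑[ u ← 𝔸 ] fibreCount u
      ≡⟨ cong₂ (λ s t → Y * s + - f * t) ∑-fibreCount-flatsThrough ∑-fibreCount ⟩
    Y * (p * f) + - f * (Y * p)
      ≡⟨ cancel Y p f ⟩
    0ℤ ∎
    where
    open ≡-Reasoning
    expand : ∀ Y f π r → π * (Y * r - f) ≡ Y * (π * r) + - f * π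
    expand = solve-∀
    cancel : ∀ Y p f → Y * (p * f) + - f * (Y * p) ≡ 0ℤ
    cancel = solve-∀

  ∑-pointExcess-flatExcess : ∑[ u ← 𝔸 ] (pointExcess u * flatExcess u) ≡ Y * (Y * I - p * f)
  ∑-pointExcess-flatExcess = begin
    ∑[ u ← 𝔸 ] (pointExcess u * flatExcess u)
      ≡⟨ ∑-cong 𝔸 (λ u → expand Y (𝟙ᴾ u) (fibreCount u) (flatExcess u)) ⟩
    ∑[ u ← 𝔸 ] (Y * (𝟙ᴾ u * flatExcess u) + - 1ℤ * (fibreCount u * flatExcess u))
      ≡⟨ ∑-linear 𝔸 Y (- 1ℤ) (λ u → 𝟙ᴾ u * flatExcess u) (λ u → fibreCount u * flatExcess u) ⟩
    Y * ∑[ u ← 𝔸 ] (𝟙ᴾ u * flatExcess u) + - 1ℤ * ∑[ u ← 𝔸 ] (fibreCount u * flatExcess u)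
      ≡⟨ cong₂ (λ s t → Y * s + - 1ℤ * t) ∑-𝟙ᴾ-flatExcess ∑-fibreCount-flatExcess ⟩
    Y * (Y * I - p * f) + - 1ℤ * 0ℤ
      ≡⟨ ℤ.+-identityʳ _ ⟩
    Y * (Y * I - p * f) ∎
    where
    open ≡-Reasoning
    expand : ∀ Y a π e → (Y * a - π) * e ≡ Y * (a * e) + - 1ℤ * (π * e)
    expand = solve-∀

  ∑-pointExcess² : ∑[ u ← 𝔸 ] (pointExcess u * pointExcess u) ≡ Y * Y * p - Y * S
  ∑-pointExcess² = begin
    ∑[ u ← 𝔸 ] (pointExcess u * pointExcess u)
      ≡⟨ ∑-cong 𝔸 (λ u → expand Y (𝟙ᴾ u) (fibreCount u)) ⟩
    ∑[ u ← 𝔸 ] (Y * Y * (𝟙ᴾ u * 𝟙ᴾ u) + - (+ 2 * Y) * (𝟙ᴾ u * fibreCount u)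
                + 1ℤ * (fibreCount u * fibreCount u))
      ≡⟨ ∑-linear₃ 𝔸 (Y * Y) (- (+ 2 * Y)) 1ℤ (λ u → 𝟙ᴾ u * 𝟙ᴾ u) (λ u → 𝟙ᴾ u * fibreCount u)
                   (λ u → fibreCount u * fibreCount u) ⟩
    Y * Y * ∑[ u ← 𝔸 ] (𝟙ᴾ u * 𝟙ᴾ u) + - (+ 2 * Y) * ∑[ u ← 𝔸 ] (𝟙ᴾ u * fibreCount u)
      + 1ℤ * ∑[ u ← 𝔸 ] (fibreCount u * fibreCount u)
      ≡⟨ cong₂ (λ s t → Y * Y * s + - (+ 2 * Y) * t + 1ℤ * ∑[ u ← 𝔸 ] (fibreCount u * fibreCount u))
               ∑-𝟙ᴾ² (∑-𝟙ᴾ fibreCount) ⟩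
    Y * Y * p + - (+ 2 * Y) * S + 1ℤ * ∑[ u ← 𝔸 ] (fibreCount u * fibreCount u)
      ≡⟨ cong (λ r → Y * Y * p + - (+ 2 * Y) * S + 1ℤ * r) ∑-fibreCount² ⟩
    Y * Y * p + - (+ 2 * Y) * S + 1ℤ * (Y * S)
      ≡⟨ collect Y p S ⟩
    Y * Y * p - Y * S ∎
    where
    open ≡-Reasoning
    expand : ∀ Y a π → (Y * a - π) * (Y * a - π)
                     ≡ Y * Y * (a * a) + - (+ 2 * Y) * (a * π) + 1ℤ * (π * π)
    expand = solve-∀
    collect : ∀ Y p S → Y * Y * p + - (+ 2 * Y) * S + 1ℤ * (Y * S) ≡ Y * Y * p - Y * S
    collect = solve-∀

  pointExcess-bound : ∑[ u ← 𝔸 ] (pointExcess u * pointExcess u) ≤ Y * p * (Y - 1ℤ)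
  pointExcess-bound = begin
    ∑[ u ← 𝔸 ] (pointExcess u * pointExcess u) ≡⟨ ∑-pointExcess² ⟩
    Y * Y * p - Y * S                          ≤⟨ ℤ.+-monoʳ-≤ (Y * Y * p) (ℤ.neg-mono-≤ Yp≤YS) ⟩
    Y * Y * p - Y * p                          ≡⟨ factor Y p ⟩
    Y * p * (Y - 1ℤ)                           ∎
    where
    open ℤ.≤-Reasoning
    Yp≤YS : Y * p ≤ Y * S
    Yp≤YS = ℤ.*-monoˡ-≤-nonNeg Y {{nonNegative Y≥0}} p≤S
    factor : ∀ Y p → Y * Y * p - Y * p ≡ Y * p * (Y - 1ℤ)
    factor = solve-∀

  fibre-cauchy-schwarz : Y * Y * ((Y * I - p * f) * (Y * I - p * f))
                       ≤ Y * p * (Y - 1ℤ) * E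
  fibre-cauchy-schwarz = begin
    Y * Y * ((Y * I - p * f) * (Y * I - p * f))
      ≡⟨ regroup Y (Y * I - p * f) ⟩
    Y * (Y * I - p * f) * (Y * (Y * I - p * f))
      ≡⟨ cong₂ _*_ ∑-pointExcess-flatExcess ∑-pointExcess-flatExcess ⟨
    ∑[ u ← 𝔸 ] (pointExcess u * flatExcess u) * ∑[ u ← 𝔸 ] (pointExcess u * flatExcess u)
      ≤⟨ cauchy-schwarz 𝔸 pointExcess flatExcess ⟩
    ∑[ u ← 𝔸 ] (pointExcess u * pointExcess u) * E
      ≤⟨ ℤ.*-monoʳ-≤-nonNeg E {{nonNegative (∑-nonNeg 𝔸 (square-nonNeg ∘ flatExcess))}} pointExcess-bound ⟩
    Y * p * (Y - 1ℤ) * E ∎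
    where
    open ℤ.≤-Reasoning
    regroup : ∀ Y D → Y * Y * (D * D) ≡ Y * D * (Y * D)
    regroup = solve-∀

  bound-for-d≥1 : 1 ℕ.≤ d → (Y * I - p * f) ^ 2 ≤ Q ^ (2 ℕ.* d ℕ.+ n ℕ.∸ 1) * p * f * (Q + f)
  bound-for-d≥1 1≤d = ℤ.*-cancelˡ-≤-pos _ _ Q (begin
    Q * (Y * I - p * f) ^ 2                   ≡⟨ cong (Q *_) (^2≡* (Y * I - p * f)) ⟩
    Q * ((Y * I - p * f) * (Y * I - p * f))   ≤⟨ incidence-bound ⟩
    Y * Y * X * p * f * (Q + f)               ≡⟨ cong (λ t → t * p * f * (Q + f)) exponent ⟨
    Q * T * p * f * (Q + f)                   ≡⟨ reassociate Q T p f ⟩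
    Q * (T * p * f * (Q + f))                 ∎)
    where
    open ℤ.≤-Reasoning
    T : ℤ
    T = Q ^ (2 ℕ.* d ℕ.+ n ℕ.∸ 1)
    exponent : Q * T ≡ Y * Y * X
    exponent = begin-equality
      Q ^ suc (2 ℕ.* d ℕ.+ n ℕ.∸ 1) ≡⟨ cong (Q ^_) (suc[2d+n∸1]≡d+d+n d n 1≤d) ⟩
      Q ^ (d ℕ.+ d ℕ.+ n)           ≡⟨ ℤ.^-distribˡ-+-* Q (d ℕ.+ d) n ⟩
      Q ^ (d ℕ.+ d) * X             ≡⟨ cong (_* X) (ℤ.^-distribˡ-+-* Q d d) ⟩
      Y * Y * X                     ∎
    reassociate : ∀ Q T p f → Q * T * p * f * (Q + f) ≡ Q * (T * p * f * (Q + f))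
    reassociate = solve-∀

  bound-for-d≡1 : d ≡ 1 → (Q * I - p * f) ^ 2 ≤ X * (Q - 1ℤ) ^ 2 * p * f
  bound-for-d≡1 d≡1 = cancel (cancel (cancel (begin
    Q * (Q * (Q * (Q * I - p * f) ^ 2))
      ≡⟨ trans (cong (λ t → Q * (Q * (Q * t))) (^2≡* (Q * I - p * f))) (regroup Q (Q * I - p * f)) ⟩
    Q * (Q * Q * ((Q * I - p * f) * (Q * I - p * f)))
      ≤⟨ ℤ.*-monoˡ-≤-nonNeg Q fibre-cs ⟩
    Q * (Q * p * (Q - 1ℤ) * E)
      ≡⟨ regroup′ Q p E ⟩
    p * (Q - 1ℤ) * Q * (Q * E)
      ≤⟨ ℤ.*-monoˡ-≤-nonNeg (p * (Q - 1ℤ) * Q) {{nonNegative p[Q-1]Q≥0}} excess-bd ⟩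
    p * (Q - 1ℤ) * Q * (Q * Q * (X * f * (f + Q - 1ℤ)) - Q * (X * Q * f * f))
      ≡⟨ collect Q X p f ⟩
    Q * (Q * (Q * (X * ((Q - 1ℤ) * (Q - 1ℤ)) * p * f)))
      ≡⟨ cong (λ t → Q * (Q * (Q * (X * t * p * f)))) (^2≡* (Q - 1ℤ)) ⟨
    Q * (Q * (Q * (X * (Q - 1ℤ) ^ 2 * p * f))) ∎)))
    where
    open ℤ.≤-Reasoning
    cancel : ∀ {i j} → Q * i ≤ Q * j → i ≤ j
    cancel = ℤ.*-cancelˡ-≤-pos _ _ Q
    Y≡Q : Y ≡ Q
    Y≡Q = trans (cong (Q ^_) d≡1) (ℤ.^-identityʳ Q)
    fibre-cs : Q * Q * ((Q * I - p * f) * (Q * I - p * f)) ≤ Q * p * (Q - 1ℤ) * E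
    fibre-cs = subst (λ y → y * y * ((y * I - p * f) * (y * I - p * f)) ≤ y * p * (y - 1ℤ) * E)
                     Y≡Q fibre-cauchy-schwarz
    excess-bd : Q * E ≤ Q * Q * (X * f * (f + Q - 1ℤ)) - Q * (X * Q * f * f)
    excess-bd = subst (λ y → Q * E ≤ y * y * (X * f * (f + Q - 1ℤ)) - Q * (X * y * f * f))
                      Y≡Q flatExcess-bound
    p[Q-1]Q≥0 : 0ℤ ≤ p * (Q - 1ℤ) * Q
    p[Q-1]Q≥0 = *-nonNeg (*-nonNeg p≥0 (ℤ.i≤j⇒0≤j-i 1≤Q)) Q≥0
    regroup : ∀ Q D → Q * (Q * (Q * (D * D))) ≡ Q * (Q * Q * (D * D))
    regroup = solve-∀
    regroup′ : ∀ Q p E → Q * (Q * p * (Q - 1ℤ) * E) ≡ p * (Q - 1ℤ) * Q * (Q * E)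
    regroup′ = solve-∀
    collect : ∀ Q X p f → p * (Q - 1ℤ) * Q * (Q * Q * (X * f * (f + Q - 1ℤ)) - Q * (X * Q * f * f))
                        ≡ Q * (Q * (Q * (X * ((Q - 1ℤ) * (Q - 1ℤ)) * p * f)))
    collect = solve-∀

-- The first bound holds already for d ≥ 1, and neither part needs n ≥ 1.
corollary1p7 : ∀ {q : ℕ} (𝔽 : FiniteField q) (n d : ℕ) → 1 ℕ.≤ n → 1 ℕ.≤ d →
    (P : List (Vec (FiniteField.Carrier 𝔽) (n ℕ.+ d))) → Unique P →
    (F : List (Vec (Vec (FiniteField.Carrier 𝔽) (suc n)) d)) → Unique F →
    let I = + incidences 𝔽 n d P F
        p = + length P
        f = + length F
        Q = + q
    in (2 ℕ.≤ d →
          ((Q ^ d) * I - p * f) ^ 2 ≤ Q ^ (2 ℕ.* d ℕ.+ n ℕ.∸ 1) * p * f * (Q + f))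
       × (d ≡ 1 →
          (Q * I - p * f) ^ 2 ≤ Q ^ n * (Q - + 1) ^ 2 * p * f)
corollary1p7 𝔽 n d _ 1≤d P P-unique F F-unique =
  (λ _ → bound-for-d≥1 1≤d) , bound-for-d≡1
  where open Incidences 𝔽 P P-unique F F-unique
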